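{- For all $n\ge0$, \[ c_{n+3}^2-1=\sum_{k=0}^n\left\{c_k^2+2\sum_{i=0}^kp_{k+2-i}c_i^2\right\}. \]
   Context: The Narayana's cows numbers $c_n$ are defined by $c_n=\delta_{n,0}+c_{n-1}+c_{n-3}$ for $n\ge0$, $c_n=0$ for $n<0$. The Padovan numbers $p_n$ are defined by $p_n=\delta_{n,0}+p_{n-2}+p_{n-3}$ for $n\ge0$, $p_n=0$ for $n<0$. $\delta_{i,j}$ is $1$ if $i=j$ and $0$ otherwise. -}

module Defs where

open import Data.Nat using (ℕ; zero; suc; _+_; _*_; _∸_)

-- Narayana's cows numbers: c_n = δ_{n,0} + c_{n-1} + c_{n-3}, c_n = 0 for n < 0.
-- Unfolded: c_0 = 1, c_1 = 1, c_2 = 1, c_{n+3} = c_{n+2} + c_n.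
c : ℕ → ℕ
c zero = 1
c (suc zero) = 1
c (suc (suc zero)) = 1
c (suc (suc (suc n))) = c (suc (suc n)) + c n

-- Padovan numbers: p_n = δ_{n,0} + p_{n-2} + p_{n-3}, p_n = 0 for n < 0.
-- Unfolded: p_0 = 1, p_1 = 0, p_2 = 1, p_{n+3} = p_{n+1} + p_n.
p : ℕ → ℕ
p zero = 1
p (suc zero) = 0
p (suc (suc zero)) = 1
p (suc (suc (suc n))) = p (suc n) + p n

sumTo : ℕ → (ℕ → ℕ) → ℕ
sumTo zero f = f 0
sumTo (suc n) f = sumTo n f + f (suc n)

{-# OPTIONS --safe #-}
module Submission where

open import Defs
open import Data.Nat using (ℕ; zero; suc; _+_; _*_; _∸_; _^_; _≤_; z≤n)
open import Data.Nat.Properties using (m≤n⇒m≤1+n; ≤-refl; +-comm; +-suc; +-∸-comm; m+n∸m≡n; *-distribʳ-+; +-identityʳ; *-identityʳ)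
open import Data.Nat.Tactic.RingSolver using (solve-∀)
open import Relation.Binary.PropositionalEquality using (_≡_; refl; sym; trans; cong; cong₂; module ≡-Reasoning)

-- Write P_m(n) = Σ_{i≤n} p_{n+m-i} c_i², so the inner sum of the theorem is P_2(k).
-- Peeling off the last term of P_m(n+1) lowers n and raises m, and the Padovan
-- recurrence gives P_{m+3} = P_{m+1} + P_m; together these show by induction
-- P_0(n) = c_n c_{n+1} and P_2(n) = c_n c_{n+2}.  Then
-- c_{n+3}² = (c_{n+2} + c_n)² = c_{n+2}² + c_n² + 2 P_2(n), which telescopes down to c_2² = 1.

sumTo-cong : ∀ n {f g : ℕ → ℕ} → (∀ i → i ≤ n → f i ≡ g i) → sumTo n f ≡ sumTo n g
sumTo-cong zero    f≗g = f≗g 0 z≤n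
sumTo-cong (suc n) f≗g =
  cong₂ _+_ (sumTo-cong n (λ i i≤n → f≗g i (m≤n⇒m≤1+n i≤n))) (f≗g (suc n) ≤-refl)

sumTo-+ : ∀ n (f g : ℕ → ℕ) → sumTo n (λ i → f i + g i) ≡ sumTo n f + sumTo n g
sumTo-+ zero    f g = refl
sumTo-+ (suc n) f g = trans (cong (_+ (f (suc n) + g (suc n))) (sumTo-+ n f g))
                            (interchange (sumTo n f) (sumTo n g) (f (suc n)) (g (suc n)))
  where
  interchange : ∀ a b x y → a + b + (x + y) ≡ a + x + (b + y)
  interchange = solve-∀

p-+-rec : ∀ j m → p (j + (3 + m)) ≡ p (j + (1 + m)) + p (j + m)
p-+-rec j m = begin
  p (j + (3 + m))             ≡⟨ cong p (+-comm j (3 + m)) ⟩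
  p (3 + (m + j))             ≡⟨ cong₂ (λ x y → p x + p y) (+-comm (1 + m) j) (+-comm m j) ⟩
  p (j + (1 + m)) + p (j + m) ∎
  where open ≡-Reasoning

m^2≡m*m : ∀ x → x ^ 2 ≡ x * x
m^2≡m*m x = cong (x *_) (*-identityʳ x)

padovanConv : ℕ → ℕ → ℕ
padovanConv m n = sumTo n (λ i → p (n + m ∸ i) * c i ^ 2)

padovanConv-suc : ∀ m n → padovanConv m (suc n) ≡ padovanConv (suc m) n + p m * c (suc n) ^ 2
padovanConv-suc m n = cong₂ _+_
  (sumTo-cong n (λ i _ → cong (λ x → p (x ∸ i) * c i ^ 2) (sym (+-suc n m))))
  (cong (λ x → p x * c (suc n) ^ 2) (m+n∸m≡n n m))

padovanConv-rec : ∀ m n → padovanConv (3 + m) n ≡ padovanConv (1 + m) n + padovanConv m n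
padovanConv-rec m n = trans (sumTo-cong n termwise) (sumTo-+ n _ _)
  where
  termwise : ∀ i → i ≤ n →
    p (n + (3 + m) ∸ i) * c i ^ 2 ≡ p (n + (1 + m) ∸ i) * c i ^ 2 + p (n + m ∸ i) * c i ^ 2
  termwise i i≤n
    rewrite +-∸-comm (3 + m) i≤n | +-∸-comm (1 + m) i≤n | +-∸-comm m i≤n | p-+-rec (n ∸ i) m
    = *-distribʳ-+ (c i ^ 2) (p (n ∸ i + (1 + m))) (p (n ∸ i + m))

padovanConv-1-suc : ∀ n → padovanConv 1 (suc n) ≡ padovanConv 2 n
padovanConv-1-suc n = trans (padovanConv-suc 1 n) (+-identityʳ (padovanConv 2 n))

mutual
  padovanConv-0 : ∀ n → padovanConv 0 n ≡ c n * c (suc n)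
  padovanConv-0 zero          = refl
  padovanConv-0 (suc zero)    = refl
  padovanConv-0 (suc (suc n)) = begin
    padovanConv 0 (2 + n)                     ≡⟨ padovanConv-suc 0 (suc n) ⟩
    padovanConv 1 (1 + n) + 1 * c (2 + n) ^ 2 ≡⟨ cong (_+ 1 * c (2 + n) ^ 2)
                                                   (trans (padovanConv-1-suc n) (padovanConv-2 n)) ⟩
    c (2 + n) * c n + 1 * c (2 + n) ^ 2       ≡⟨ factor (c n) (c (2 + n)) ⟩
    c (2 + n) * c (3 + n)                     ∎
    where
    open ≡-Reasoning
    factor : ∀ a d → d * a + 1 * d ^ 2 ≡ d * (d + a)
    factor a d rewrite m^2≡m*m d = ring a d
      where
      ring : ∀ a d → d * a + 1 * (d * d) ≡ d * (d + a)
      ring = solve-∀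

  padovanConv-2 : ∀ n → padovanConv 2 n ≡ c (2 + n) * c n
  padovanConv-2 zero          = refl
  padovanConv-2 (suc zero)    = refl
  padovanConv-2 (suc (suc n)) = begin
    padovanConv 2 (2 + n)
      ≡⟨ padovanConv-suc 2 (suc n) ⟩
    padovanConv 3 (1 + n) + 1 * c (2 + n) ^ 2
      ≡⟨ cong (_+ 1 * c (2 + n) ^ 2) (padovanConv-rec 0 (suc n)) ⟩
    padovanConv 1 (1 + n) + padovanConv 0 (1 + n) + 1 * c (2 + n) ^ 2
      ≡⟨ cong₂ (λ x y → x + y + 1 * c (2 + n) ^ 2)
               (trans (padovanConv-1-suc n) (padovanConv-2 n)) (padovanConv-0 (suc n)) ⟩
    c (2 + n) * c n + c (1 + n) * c (2 + n) + 1 * c (2 + n) ^ 2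
      ≡⟨ factor (c n) (c (1 + n)) (c (2 + n)) ⟩
    c (4 + n) * c (2 + n)
      ∎
    where
    open ≡-Reasoning
    factor : ∀ a b d → d * a + b * d + 1 * d ^ 2 ≡ ((d + a) + b) * d
    factor a b d rewrite m^2≡m*m d = ring a b d
      where
      ring : ∀ a b d → d * a + b * d + 1 * (d * d) ≡ ((d + a) + b) * d
      ring = solve-∀

c-square-step : ∀ n → c (3 + n) ^ 2 ≡ c (2 + n) ^ 2 + (c n ^ 2 + 2 * padovanConv 2 n)
c-square-step n = trans (binomial (c (2 + n)) (c n))
                        (cong (λ t → c (2 + n) ^ 2 + (c n ^ 2 + 2 * t)) (sym (padovanConv-2 n)))
  where
  binomial : ∀ x y → (x + y) ^ 2 ≡ x ^ 2 + (y ^ 2 + 2 * (x * y))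
  binomial x y rewrite m^2≡m*m (x + y) | m^2≡m*m x | m^2≡m*m y = ring x y
    where
    ring : ∀ x y → (x + y) * (x + y) ≡ x * x + (y * y + 2 * (x * y))
    ring = solve-∀

c-square-telescope : ∀ n → c (3 + n) ^ 2 ≡ suc (sumTo n (λ k → c k ^ 2 + 2 * padovanConv 2 k))
c-square-telescope zero    = refl
c-square-telescope (suc n) = trans (c-square-step (suc n))
  (cong (_+ (c (suc n) ^ 2 + 2 * padovanConv 2 (suc n))) (c-square-telescope n))

mainTheorem15 : ∀ (n : ℕ) →
    c (n + 3) ^ 2 ∸ 1 ≡ sumTo n (λ k → c k ^ 2 + 2 * sumTo k (λ i → p (k + 2 ∸ i) * c i ^ 2))
mainTheorem15 n = begin
  c (n + 3) ^ 2 ∸ 1                             ≡⟨ cong (λ m → c m ^ 2 ∸ 1) (+-comm n 3) ⟩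
  c (3 + n) ^ 2 ∸ 1                             ≡⟨ cong (_∸ 1) (c-square-telescope n) ⟩
  sumTo n (λ k → c k ^ 2 + 2 * padovanConv 2 k) ∎
  where open ≡-Reasoning
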